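{- Let $k\ge2$ and fix an index $j_0\in\{2,\dots,k\}$. There is a deterministic one-way number-on-the-forehead protocol of communication cost $O(n\log^{(k-1)}n)$, in which every player is collapsing, that computes $\widehat{\textsc{mpj}}_k(i,f_2,\ldots,f_k)$ on all inputs in which $f_j$ is a permutation of $[n]$ for every $j\ne j_0$ (while $f_{j_0}\in[n]^{[n]}$ is arbitrary). In particular there is such a protocol for $\widehat{\textsc{mpj}}^{\rm perm}_k$.
   Context: Logarithms are base $2$ and $\log^{(m)}n$ is the $m$-times iterated logarithm; $[n]=\{1,\dots,n\}$. $\widehat{\textsc{mpj}}_k:[n]\times([n]^{[n]})^{k-1}\to[n]$ is given by $\widehat{\textsc{mpj}}_k(i,f_2,\ldots,f_k)=f_k\circ\cdots\circ f_2(i)$; $\widehat{\textsc{mpj}}^{\rm perm}_k$ is its restriction to inputs where all of $f_2,\dots,f_k$ are permutations of $[n]$. Write the input as $(z_1,\dots,z_k)$ with $z_1=i$, $z_j=f_j$ ($j\ge2$). In the number-on-the-forehead model $z_j$ is on player $j$'s forehead and she sees all $z_h$, $h\ne j$. In a deterministic one-way protocol, players $1,\dots,k$ each write one message on a public blackboard in this order, each a deterministic function of what she sees and earlier messages; player $k$'s message must equal the function value; cost is the worst-case total number of bits. Player $j$ is collapsing if her message depends only on the previous messages, on $z_1,\dots,z_{j-1}$, and on the function $g_j(w_1,\dots,w_j)=\widehat{\textsc{mpj}}_k(w_1,\dots,w_j,z_{j+1},\dots,z_k)$; concretely, only on the previous messages, $i,f_2,\dots,f_{j-1}$ and the composition $f_k\circ\cdots\circ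 f_{j+1}$. -}

module Defs where

open import Data.Nat using (ℕ; zero; suc; _+_; _∸_)
open import Data.Nat.Logarithm using (⌊log₂_⌋)
open import Data.Fin using (Fin)
open import Data.Bool using (Bool)
open import Data.List using (List; []; _∷_; _++_; [_]; take; drop; length; map)
open import Data.Nat.ListAction using (sum)
open import Data.Vec using (Vec; toList)
open import Function using (id; _∘_)

ilog : ℕ → ℕ → ℕ
ilog zero n = n
ilog (suc m) n = ⌊log₂ (ilog m n) ⌋

Fun : ℕ → Set
Fun n = Fin n → Fin n

Bits : Set
Bits = List Bool

comp : ∀ {n} → List (Fun n) → Fun n
comp [] = id
comp (f ∷ fs) = comp fs ∘ f

-- The input is (i , fs) with fs = [f₂ , … , f_k] a vector of length k ∸ 1.
-- mpĵ_k(i, f₂, …, f_k) = f_k ∘ ⋯ ∘ f₂ (i)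
mpj : ∀ {n m} → Fin n → Vec (Fun n) m → Fin n
mpj i fs = comp (toList fs) i

-- A deterministic one-way NOF protocol for k players on [n] in which every
-- player is collapsing: each player's message is, by construction, a
-- function only of the previous messages, of z₁,…,z_{j-1} and of the
-- composition f_k ∘ ⋯ ∘ f_{j+1}.
record CollapsingProtocol (k n : ℕ) : Set where
  field
    -- player 1: sees only f_k ∘ ⋯ ∘ f₂ (no previous messages, no prefix)
    first  : Fun n → Bits
    -- player j = q + 2: sees i, [f₂,…,f_{j-1}], f_k ∘ ⋯ ∘ f_{j+1},
    -- and the list of previous messages (of players 1,…,j-1)
    later  : (q : ℕ) → Fin n → List (Fun n) → Fun n → List Bits → Bits
    -- fixed encoding of elements of [n] by bit strings: player k's
    -- message (read through this encoding) must be the function value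
    decode : Bits → Fin n

module _ {k n : ℕ} (P : CollapsingProtocol k n) (i : Fin n) (fs : Vec (Fun n) (k ∸ 1)) where
  open CollapsingProtocol P

  private
    L : List (Fun n)
    L = toList fs

  -- transcript q = messages of players 1, …, q + 1 (in order)
  transcript : ℕ → List Bits
  transcript zero = [ first (comp L) ]
  transcript (suc q) =
    transcript q ++ [ later q i (take q L) (comp (drop (suc q) L)) (transcript q) ]

  -- message of the last player k (= q + 2 with q = k ∸ 2)
  lastMessage : Bits
  lastMessage = later (k ∸ 2) i (take (k ∸ 2) L) (comp (drop (k ∸ 1) L)) (transcript (k ∸ 2))

  output : Fin n
  output = decode lastMessage

  cost : ℕ
  cost = sum (map length (transcript (k ∸ 2) ++ [ lastMessage ]))

-- The players 1, …, k − 1 shrink a public set S ⊆ [n] of candidates for the answer, starting from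
-- S = [n].  Player t knows g = f_k ∘ ⋯ ∘ f_{t+1}; she writes R = g⁻¹(S) as a bit vector and a
-- (b + 2)-bit code of every v ∈ S and of g y for every y ∈ R.  Listing R by image, the preimages of v
-- form a run, and code v says in which block of length T = ⌊|R| / 2^b⌋ + 1 the run starts and whether
-- it fills a whole block (heavy) or not (light).  Whoever knows x = f_t ∘ ⋯ ∘ f₂ (i) finds the code of
-- the answer g x among the codes of R and keeps the candidates sharing it: a heavy code leaves one
-- candidate, a light one leaves candidates with at most 2T preimages in all.  As every f_j except
-- f_{j₀} is a permutation, the preimage set of the next player is no larger (if f_{t+1} = f_{j₀} then
-- all later maps are injective and S lies in the image of g).  With b = log^{(k−t)} n + 1 player t then
-- writes O(n) bits, the first player O(n log^{(k−1)} n); player k − 1 has 2^b > n, so T = 1 and only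
-- the answer survives, and player k writes the final candidate set.

module Submission where

open import Defs
open import Data.Bool using (Bool; true; false; _∧_; not; if_then_else_)
import Data.Bool as Bool
open import Data.Bool.Properties using (∧-zeroʳ)
open import Data.Fin using (Fin; zero; suc; toℕ; fromℕ<; _≟_)
open import Data.Fin.Properties using (any?; toℕ-injective; toℕ-fromℕ<)
open import Data.List using (List; []; _∷_; _++_; length; map; filterᵇ; allFin; applyUpTo; tabulate; take; drop; concatMap)
open import Data.List.Properties using (length-++; length-map; length-tabulate; length-take; length-applyUpTo; ∷-injective; ++-assoc; ++-identityʳ; take++drop≡id; ≡-dec)
open import Data.List.Membership.Propositional using (_∈_)
open import Data.List.Membership.Propositional.Properties using (∈-∃++; ∈-map⁻; ∈-allFin; ∈-applyUpTo⁺)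
open import Data.List.Relation.Unary.Any using (here; there)
import Data.List.Relation.Unary.All as All
import Data.List.Relation.Unary.All.Properties as All
open import Data.List.Relation.Unary.Unique.Propositional using (Unique; []; _∷_)
import Data.List.Relation.Unary.Unique.Propositional.Properties as Unique
open import Data.Nat using (ℕ; zero; suc; _+_; _*_; _∸_; _^_; _⊓_; _≤_; _<_; z≤n; s≤s; NonZero; >-nonZero)
open import Data.Nat.DivMod using (_/_; _%_; m≡m%n+[m/n]*n; m%n<n; /-monoˡ-≤; m<n*o⇒m/o<n; m/n*n≤m; m*n/n≡m; m<n⇒m/n≡0)
open import Data.Nat.ListAction using (sum)
open import Data.Nat.Logarithm using (⌊log₂_⌋; ⌊log₂⌋-mono-≤; ⌊log₂[2^n]⌋≡n)
open import Data.Nat.Properties renaming (_≟_ to _≟ℕ_)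
open import Data.Nat.Tactic.RingSolver using (solve-∀)
open import Data.Product using (Σ; _×_; _,_; proj₁; proj₂; map₁; ∃; ∃-syntax)
open import Data.Sum using (_⊎_; inj₁; inj₂)
open import Data.Unit using (⊤)
open import Data.Vec using (Vec; []; _∷_; lookup; toList)
open import Data.Vec.Properties using (length-toList)
open import Function using (_∘_; id)
open import Function.Definitions using (Injective; Bijective)
open import Relation.Binary.Definitions using (DecidableEquality; tri<; tri≈; tri>)
open import Relation.Binary.PropositionalEquality
open import Relation.Nullary using (contradiction; Dec; yes; no; does)
open import Relation.Nullary.Decidable using (dec-true; dec-false)

does⇒ : {P : Set} (p? : Dec P) → does p? ≡ true → P
does⇒ (yes p) _ = p

∧-true : ∀ {a b} → a ≡ true → b ≡ true → a ∧ b ≡ true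
∧-true refl refl = refl

∧-trueˡ : ∀ a {b} → a ∧ b ≡ true → a ≡ true
∧-trueˡ true _ = refl

∧-trueʳ : ∀ a {b} → a ∧ b ≡ true → b ≡ true
∧-trueʳ true b≡true = b≡true

-- Counting with boolean predicates

count : {A : Set} → (A → Bool) → List A → ℕ
count p xs = length (filterᵇ p xs)

module _ {A : Set} where

  ∈-filterᵇ⁺ : (p : A → Bool) {xs : List A} {x : A} → x ∈ xs → p x ≡ true → x ∈ filterᵇ p xs
  ∈-filterᵇ⁺ p {y ∷ xs} (here refl) px rewrite px = here refl
  ∈-filterᵇ⁺ p {y ∷ xs} (there x∈xs) px with p y
  ... | true  = there (∈-filterᵇ⁺ p x∈xs px)
  ... | false = ∈-filterᵇ⁺ p x∈xs px

  ∈-filterᵇ⁻ : (p : A → Bool) {xs : List A} {x : A} → x ∈ filterᵇ p xs → x ∈ xs × p x ≡ true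
  ∈-filterᵇ⁻ p {y ∷ xs} x∈ with p y in py
  ∈-filterᵇ⁻ p {y ∷ xs} (here refl)  | true  = here refl , py
  ∈-filterᵇ⁻ p {y ∷ xs} (there x∈)   | true  = map₁ there (∈-filterᵇ⁻ p x∈)
  ∈-filterᵇ⁻ p {y ∷ xs} x∈           | false = map₁ there (∈-filterᵇ⁻ p x∈)

  filterᵇ-cong : (p q : A → Bool) (xs : List A) →
    (∀ x → x ∈ xs → p x ≡ q x) → filterᵇ p xs ≡ filterᵇ q xs
  filterᵇ-cong p q []       p≡q = refl
  filterᵇ-cong p q (x ∷ xs) p≡q with p x | q x | p≡q x (here refl)
  ... | true  | true  | refl = cong (x ∷_) (filterᵇ-cong p q xs (λ y y∈ → p≡q y (there y∈)))
  ... | false | false | refl = filterᵇ-cong p q xs (λ y y∈ → p≡q y (there y∈))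

  count-split : (p b : A → Bool) (xs : List A) →
    count p xs ≡ count (λ x → p x ∧ b x) xs + count (λ x → p x ∧ not (b x)) xs
  count-split p b [] = refl
  count-split p b (x ∷ xs) with p x | b x
  ... | true  | true  = cong suc (count-split p b xs)
  ... | true  | false = trans (cong suc (count-split p b xs)) (sym (+-suc _ _))
  ... | false | _     = count-split p b xs

  count≤length : (p : A → Bool) (xs : List A) → count p xs ≤ length xs
  count≤length p [] = z≤n
  count≤length p (x ∷ xs) with p x
  ... | true  = s≤s (count≤length p xs)
  ... | false = m≤n⇒m≤1+n (count≤length p xs)

  count-witness : (p : A → Bool) (xs : List A) → 1 ≤ count p xs → ∃ λ a → a ∈ xs × p a ≡ true
  count-witness p (x ∷ xs) c with p x in px
  ... | true  = x , here refl , px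
  ... | false = let a , a∈ , pa = count-witness p xs c in a , there a∈ , pa

  ∈-++-remove : ∀ {z w : A} (us vs : List A) → w ∈ us ++ z ∷ vs → w ≢ z → w ∈ us ++ vs
  ∈-++-remove []       vs (here refl) w≢z = contradiction refl w≢z
  ∈-++-remove []       vs (there w∈)  w≢z = w∈
  ∈-++-remove (u ∷ us) vs (here refl) w≢z = here refl
  ∈-++-remove (u ∷ us) vs (there w∈)  w≢z = there (∈-++-remove us vs w∈ w≢z)

  Unique-length-≤ : (zs ys : List A) → Unique zs → (∀ z → z ∈ zs → z ∈ ys) →
    length zs ≤ length ys
  Unique-length-≤ []       ys _ _ = z≤n
  Unique-length-≤ (z ∷ zs) ys uniq@(_ ∷ uniq-zs) zs⊆ys with ∈-∃++ (zs⊆ys z (here refl))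
  ... | us , vs , refl = begin
      suc (length zs)              ≤⟨ s≤s (Unique-length-≤ zs (us ++ vs) uniq-zs zs⊆us++vs) ⟩
      suc (length (us ++ vs))      ≡⟨ cong suc (length-++ us) ⟩
      suc (length us + length vs)  ≡⟨ sym (+-suc (length us) (length vs)) ⟩
      length us + length (z ∷ vs)  ≡⟨ sym (length-++ us) ⟩
      length (us ++ z ∷ vs)        ∎
    where
      open ≤-Reasoning
      zs⊆us++vs : ∀ w → w ∈ zs → w ∈ us ++ vs
      zs⊆us++vs w w∈ = ∈-++-remove us vs (zs⊆ys w (there w∈))
        (λ { refl → Unique.Unique[x∷xs]⇒x∉xs uniq w∈ })

  count-mono : (p q : A → Bool) (xs : List A) →
    (∀ x → x ∈ xs → p x ≡ true → q x ≡ true) → count p xs ≤ count q xs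
  count-mono p q [] p⇒q = z≤n
  count-mono p q (x ∷ xs) p⇒q with p x in px | q x in qx
  ... | true  | true  = s≤s (count-mono p q xs (λ y y∈ → p⇒q y (there y∈)))
  ... | true  | false = contradiction (trans (sym (p⇒q x (here refl) px)) qx) λ ()
  ... | false | true  = m≤n⇒m≤1+n (count-mono p q xs (λ y y∈ → p⇒q y (there y∈)))
  ... | false | false = count-mono p q xs (λ y y∈ → p⇒q y (there y∈))

  count-mono-< : (p q : A → Bool) (xs : List A) →
    (∀ x → x ∈ xs → p x ≡ true → q x ≡ true) →
    ∀ {a} → a ∈ xs → q a ≡ true → p a ≡ false → count p xs < count q xs
  count-mono-< p q (x ∷ xs) p⇒q (here refl) qa pa rewrite qa | pa =
    s≤s (count-mono p q xs (λ y y∈ → p⇒q y (there y∈)))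
  count-mono-< p q (x ∷ xs) p⇒q (there a∈) qa pa with p x in px | q x in qx
  ... | true  | true  = s≤s (count-mono-< p q xs (λ y y∈ → p⇒q y (there y∈)) a∈ qa pa)
  ... | true  | false = contradiction (trans (sym (p⇒q x (here refl) px)) qx) λ ()
  ... | false | true  = m≤n⇒m≤1+n (count-mono-< p q xs (λ y y∈ → p⇒q y (there y∈)) a∈ qa pa)
  ... | false | false = count-mono-< p q xs (λ y y∈ → p⇒q y (there y∈)) a∈ qa pa

  count-pos : (p : A → Bool) (xs : List A) → ∀ {a} → a ∈ xs → p a ≡ true → 1 ≤ count p xs
  count-pos p (x ∷ xs) (here refl) pa rewrite pa = s≤s z≤n
  count-pos p (x ∷ xs) (there a∈) pa with p x
  ... | true  = s≤s z≤n
  ... | false = count-pos p xs a∈ pa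

  count≤1⇒unique : (p : A → Bool) (xs : List A) → count p xs ≤ 1 →
    ∀ {a b} → a ∈ xs → b ∈ xs → p a ≡ true → p b ≡ true → a ≡ b
  count≤1⇒unique p xs c a∈ b∈ pa pb =
    atMostOne (filterᵇ p xs) c (∈-filterᵇ⁺ p a∈ pa) (∈-filterᵇ⁺ p b∈ pb)
    where
      atMostOne : (zs : List A) → length zs ≤ 1 → ∀ {a b} → a ∈ zs → b ∈ zs → a ≡ b
      atMostOne (z ∷ [])     _         (here refl) (here refl) = refl
      atMostOne (z ∷ _ ∷ _) (s≤s ())  _           _

module _ {A B : Set} where

  Unique-map-on : (φ : A → B) {xs : List A} → Unique xs →
    (∀ {a b} → a ∈ xs → b ∈ xs → φ a ≡ φ b → a ≡ b) → Unique (map φ xs)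
  Unique-map-on φ {[]}     []          inj = []
  Unique-map-on φ {x ∷ xs} (x≢ ∷ uniq) inj =
    All.map⁺ (All.tabulate (λ y∈ φx≡φy → All.lookup x≢ y∈ (inj (here refl) (there y∈) φx≡φy)))
    ∷ Unique-map-on φ uniq (λ a∈ b∈ → inj (there a∈) (there b∈))

  count-injection : (p : A → Bool) {xs : List A} (ys : List B) (φ : A → B) → Unique xs →
    (∀ x → x ∈ xs → p x ≡ true → φ x ∈ ys) →
    (∀ {a b} → a ∈ xs → b ∈ xs → p a ≡ true → p b ≡ true → φ a ≡ φ b → a ≡ b) →
    count p xs ≤ length ys
  count-injection p {xs} ys φ uniq maps inj = begin
      count p xs                      ≡⟨ sym (length-map φ (filterᵇ p xs)) ⟩
      length (map φ (filterᵇ p xs))   ≤⟨ Unique-length-≤ _ ys uniq-image image⊆ys ⟩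
      length ys                       ∎
    where
      open ≤-Reasoning
      uniq-image : Unique (map φ (filterᵇ p xs))
      uniq-image = Unique-map-on φ (Unique.filter⁺ _ uniq) λ a∈ b∈ →
        let a∈xs , pa = ∈-filterᵇ⁻ p a∈ ; b∈xs , pb = ∈-filterᵇ⁻ p b∈ in inj a∈xs b∈xs pa pb
      image⊆ys : ∀ z → z ∈ map φ (filterᵇ p xs) → z ∈ ys
      image⊆ys z z∈ with ∈-map⁻ φ z∈
      ... | x , x∈ , refl = let x∈xs , px = ∈-filterᵇ⁻ p x∈ in maps x x∈xs px

-- Subsets of Fin n

module _ {n : ℕ} where

  ∣_∣ : (Fin n → Bool) → ℕ
  ∣ p ∣ = count p (allFin n)

  _⊆-image_ : (Fin n → Bool) → (Fin n → Fin n) → Set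
  S ⊆-image g = ∀ v → S v ≡ true → ∃ λ y → g y ≡ v

  ∣p∣≤n : (p : Fin n → Bool) → ∣ p ∣ ≤ n
  ∣p∣≤n p = subst (∣ p ∣ ≤_) (length-tabulate id) (count≤length p (allFin n))

  ∣∣-cong : (p q : Fin n → Bool) → (∀ y → p y ≡ q y) → ∣ p ∣ ≡ ∣ q ∣
  ∣∣-cong p q p≗q = cong length (filterᵇ-cong p q (allFin n) (λ y _ → p≗q y))

  ∣∣-mono : (p q : Fin n → Bool) → (∀ y → p y ≡ true → q y ≡ true) → ∣ p ∣ ≤ ∣ q ∣
  ∣∣-mono p q p⇒q = count-mono p q (allFin n) (λ y _ → p⇒q y)

  ∣∣-injection : (p q : Fin n → Bool) (φ : Fin n → Fin n) →
    (∀ y → p y ≡ true → q (φ y) ≡ true) →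
    (∀ {a b} → p a ≡ true → p b ≡ true → φ a ≡ φ b → a ≡ b) → ∣ p ∣ ≤ ∣ q ∣
  ∣∣-injection p q φ maps inj =
    count-injection p (filterᵇ q (allFin n)) φ (Unique.allFin⁺ n)
      (λ y _ py → ∈-filterᵇ⁺ q (∈-allFin (φ y)) (maps y py))
      (λ _ _ → inj)

  ∣∣≤1 : (p : Fin n → Bool) → (∀ {a b} → p a ≡ true → p b ≡ true → a ≡ b) → ∣ p ∣ ≤ 1
  ∣∣≤1 p unique with filterᵇ p (allFin n) in eq
  ... | []    = z≤n
  ... | a ∷ _ = subst (λ zs → length zs ≤ 1) eq
    (count-injection p (a ∷ []) id (Unique.allFin⁺ n)
      (λ y _ py → here (unique py (proj₂ (∈-filterᵇ⁻ p {allFin n} (subst (a ∈_) (sym eq) (here refl))))))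
      (λ _ _ _ _ → id))

  ∣∣≤1⇒unique : (p : Fin n → Bool) → ∣ p ∣ ≤ 1 → ∀ {a b} → p a ≡ true → p b ≡ true → a ≡ b
  ∣∣≤1⇒unique p c = count≤1⇒unique p (allFin n) c (∈-allFin _) (∈-allFin _)

  search : (Fin n → Bool) → Fin n → Fin n
  search p default with any? (λ y → p y Bool.≟ true)
  ... | yes (y , _) = y
  ... | no  _       = default

  search-correct : (p : Fin n → Bool) (default : Fin n) → ∀ {a} → p a ≡ true → p (search p default) ≡ true
  search-correct p default {a} pa with any? (λ y → p y Bool.≟ true)
  ... | yes (_ , py) = py
  ... | no  none     = contradiction (a , pa) none

  preimage : (Fin n → Fin n) → Fin n → Fin n
  preimage g v = search (λ y → does (g y ≟ v)) v

  preimage-correct : (g : Fin n → Fin n) → ∀ {v} → (∃ λ y → g y ≡ v) → g (preimage g v) ≡ v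
  preimage-correct g {v} (y , gy≡v) =
    does⇒ (g _ ≟ v) (search-correct (λ y → does (g y ≟ v)) v (dec-true (g y ≟ v) gy≡v))

  ∣∣-image : (p : Fin n → Bool) (g : Fin n → Fin n) → p ⊆-image g → ∣ p ∣ ≤ ∣ p ∘ g ∣
  ∣∣-image p g p⊆img = ∣∣-injection p (p ∘ g) (preimage g)
    (λ v pv → subst (λ w → p w ≡ true) (sym (preimage-correct g (p⊆img v pv))) pv)
    (λ {a} {b} pa pb eq → begin
      a                     ≡⟨ sym (preimage-correct g (p⊆img a pa)) ⟩
      g (preimage g a)      ≡⟨ cong g eq ⟩
      g (preimage g b)      ≡⟨ preimage-correct g (p⊆img b pb) ⟩
      b                     ∎)
    where open ≡-Reasoning

  ∣∣-preimage-injective : (p : Fin n → Bool) (g : Fin n → Fin n) → Injective _≡_ _≡_ g →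
    ∣ p ∘ g ∣ ≤ ∣ p ∣
  ∣∣-preimage-injective p g inj = ∣∣-injection (p ∘ g) p g (λ _ pgy → pgy) (λ _ _ → inj)

  Narrowed : (Fin n → Bool) → (Fin n → Fin n) → ℕ → Set
  Narrowed S g B = ∣ S ∣ ≤ 1 ⊎ (S ⊆-image g × ∣ S ∘ g ∣ ≤ B)

  Narrowed-cong : ∀ {S S′ g B} → (∀ v → S v ≡ S′ v) → Narrowed S g B → Narrowed S′ g B
  Narrowed-cong {S} {S′} S≗S′ (inj₁ ∣S∣≤1) = inj₁ (subst (_≤ 1) (∣∣-cong S S′ S≗S′) ∣S∣≤1)
  Narrowed-cong {S} {S′} {g} S≗S′ (inj₂ (S⊆img , ∣Sg∣≤B)) =
    inj₂ ((λ v S′v → S⊆img v (trans (S≗S′ v) S′v)) ,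
          subst (_≤ _) (∣∣-cong (S ∘ g) (S′ ∘ g) (S≗S′ ∘ g)) ∣Sg∣≤B)

-- Codes and bit strings

toBits : ℕ → ℕ → Bits
toBits zero    m = []
toBits (suc b) m with 2 ^ b ≤? m
... | yes _ = true  ∷ toBits b (m ∸ 2 ^ b)
... | no  _ = false ∷ toBits b m

length-toBits : ∀ b m → length (toBits b m) ≡ b
length-toBits zero    m = refl
length-toBits (suc b) m with 2 ^ b ≤? m
... | yes _ = cong suc (length-toBits b (m ∸ 2 ^ b))
... | no  _ = cong suc (length-toBits b m)

m∸2^b<2^b : ∀ b {m} → 2 ^ b ≤ m → m < 2 ^ suc b → m ∸ 2 ^ b < 2 ^ b
m∸2^b<2^b b {m} 2^b≤m m< = begin-strict
    m ∸ 2 ^ b                        <⟨ ∸-monoˡ-< m< 2^b≤m ⟩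
    2 ^ b + (2 ^ b + 0) ∸ 2 ^ b      ≡⟨ m+n∸m≡n (2 ^ b) (2 ^ b + 0) ⟩
    2 ^ b + 0                        ≡⟨ +-identityʳ (2 ^ b) ⟩
    2 ^ b                            ∎
  where open ≤-Reasoning

toBits-injective : ∀ b {m m′} → m < 2 ^ b → m′ < 2 ^ b → toBits b m ≡ toBits b m′ → m ≡ m′
toBits-injective zero {zero} {zero} _ _ _ = refl
toBits-injective zero {suc _} (s≤s ())
toBits-injective zero {m′ = suc _} _ (s≤s ())
toBits-injective (suc b) {m} {m′} m< m′< eq with 2 ^ b ≤? m | 2 ^ b ≤? m′
... | yes p | yes p′ = begin
    m                    ≡⟨ sym (m∸n+n≡m p) ⟩
    m ∸ 2 ^ b + 2 ^ b    ≡⟨ cong (_+ 2 ^ b) (toBits-injective b (m∸2^b<2^b b p m<) (m∸2^b<2^b b p′ m′<)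
                                              (proj₂ (∷-injective eq))) ⟩
    m′ ∸ 2 ^ b + 2 ^ b   ≡⟨ m∸n+n≡m p′ ⟩
    m′                   ∎
  where open ≡-Reasoning
... | no ¬p | no ¬p′ = toBits-injective b (≰⇒> ¬p) (≰⇒> ¬p′) (proj₂ (∷-injective eq))

data Code : Set where
  absent       : Code
  heavy light  : ℕ → Code

encode : ℕ → Code → Bits
encode b absent    = false ∷ false ∷ toBits b 0
encode b (heavy c) = true  ∷ true  ∷ toBits b c
encode b (light c) = true  ∷ false ∷ toBits b c

FitsIn : ℕ → Code → Set
FitsIn b absent    = ⊤
FitsIn b (heavy c) = c < 2 ^ b
FitsIn b (light c) = c < 2 ^ b

length-encode : ∀ b c → length (encode b c) ≡ 2 + b
length-encode b absent    = cong (2 +_) (length-toBits b 0)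
length-encode b (heavy c) = cong (2 +_) (length-toBits b c)
length-encode b (light c) = cong (2 +_) (length-toBits b c)

encode-injective : ∀ b {c c′} → FitsIn b c → FitsIn b c′ → encode b c ≡ encode b c′ → c ≡ c′
encode-injective b {absent}  {absent}   _ _  _  = refl
encode-injective b {heavy c} {heavy c′} f f′ eq =
  cong heavy (toBits-injective b f f′ (proj₂ (∷-injective (proj₂ (∷-injective eq)))))
encode-injective b {light c} {light c′} f f′ eq =
  cong light (toBits-injective b f f′ (proj₂ (∷-injective (proj₂ (∷-injective eq)))))

_≟ᴮ_ : DecidableEquality Bits
_≟ᴮ_ = ≡-dec Bool._≟_

module _ {A : Set} where

  take-length-++ : (xs ys : List A) → take (length xs) (xs ++ ys) ≡ xs
  take-length-++ []       ys = refl
  take-length-++ (x ∷ xs) ys = cong (x ∷_) (take-length-++ xs ys)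

  drop-length-++ : (xs ys : List A) → drop (length xs) (xs ++ ys) ≡ ys
  drop-length-++ []       ys = refl
  drop-length-++ (x ∷ xs) ys = drop-length-++ xs ys

bitAt : ∀ {n} → Bits → Fin n → Bool
bitAt []       _       = false
bitAt (b ∷ _)  zero    = b
bitAt (_ ∷ bs) (suc y) = bitAt bs y

bitAt-tabulate-++ : ∀ {n} (p : Fin n → Bool) (rest : Bits) (y : Fin n) →
  bitAt (tabulate p ++ rest) y ≡ p y
bitAt-tabulate-++ p rest zero    = refl
bitAt-tabulate-++ p rest (suc y) = bitAt-tabulate-++ (p ∘ suc) rest y

drop-tabulate-++ : ∀ {n} (p : Fin n → Bool) (rest : Bits) → drop n (tabulate p ++ rest) ≡ rest
drop-tabulate-++ {n} p rest =
  subst (λ l → drop l (tabulate p ++ rest) ≡ rest) (length-tabulate p) (drop-length-++ (tabulate p) rest)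

blockAt : ∀ {n} → ℕ → List (Fin n) → Bits → Fin n → Bits
blockAt w []       bs v = []
blockAt w (u ∷ us) bs v = if does (u ≟ v) then take w bs else blockAt w us (drop w bs) v

module _ {n} (w : ℕ) (f : Fin n → Bits) (length-f : ∀ u → length (f u) ≡ w) where

  blockAt-concatMap : ∀ us rest {v} → v ∈ us → blockAt w us (concatMap f us ++ rest) v ≡ f v
  blockAt-concatMap (u ∷ us) rest {v} v∈ with u ≟ v | v∈
  ... | yes refl | _          = begin
      take w ((f u ++ concatMap f us) ++ rest)   ≡⟨ cong (take w) (++-assoc (f u) _ rest) ⟩
      take w (f u ++ concatMap f us ++ rest)     ≡⟨ cong (λ l → take l _) (sym (length-f u)) ⟩
      take (length (f u)) (f u ++ _)             ≡⟨ take-length-++ (f u) _ ⟩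
      f u                                        ∎
    where open ≡-Reasoning
  ... | no u≢v   | here refl  = contradiction refl u≢v
  ... | no _     | there v∈us = begin
      blockAt w us (drop w ((f u ++ concatMap f us) ++ rest)) v  ≡⟨ cong (λ bs → blockAt w us bs v) drop-block ⟩
      blockAt w us (concatMap f us ++ rest) v                     ≡⟨ blockAt-concatMap us rest v∈us ⟩
      f v                                                         ∎
    where
      open ≡-Reasoning
      drop-block : drop w ((f u ++ concatMap f us) ++ rest) ≡ concatMap f us ++ rest
      drop-block = begin
        drop w ((f u ++ concatMap f us) ++ rest)   ≡⟨ cong (drop w) (++-assoc (f u) _ rest) ⟩
        drop w (f u ++ concatMap f us ++ rest)     ≡⟨ cong (λ l → drop l _) (sym (length-f u)) ⟩
        drop (length (f u)) (f u ++ _)             ≡⟨ drop-length-++ (f u) _ ⟩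
        concatMap f us ++ rest                     ∎

  length-concatMap : ∀ us → length (concatMap f us) ≡ length us * w
  length-concatMap []       = refl
  length-concatMap (u ∷ us) = begin
    length (f u ++ concatMap f us)          ≡⟨ length-++ (f u) ⟩
    length (f u) + length (concatMap f us)  ≡⟨ cong₂ _+_ (length-f u) (length-concatMap us) ⟩
    w + length us * w                       ∎
    where open ≡-Reasoning

  drop-concatMap : ∀ us rest → drop (length us * w) (concatMap f us ++ rest) ≡ rest
  drop-concatMap us rest = subst (λ l → drop l (concatMap f us ++ rest) ≡ rest)
    (length-concatMap us) (drop-length-++ (concatMap f us) rest)

-- Arithmetic

n<2^n : ∀ n → n < 2 ^ n
n<2^n zero    = s≤s z≤n
n<2^n (suc n) = begin-strict
    suc n                  <⟨ s≤s (n<2^n n) ⟩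
    suc (2 ^ n)            ≡⟨ +-comm 1 (2 ^ n) ⟩
    2 ^ n + 1              ≤⟨ +-monoʳ-≤ (2 ^ n) (≤-trans (m^n>0 2 n) (m≤m+n (2 ^ n) 0)) ⟩
    2 ^ n + (2 ^ n + 0)    ∎
  where open ≤-Reasoning

n<2^[1+⌊log₂n⌋] : ∀ n → n < 2 ^ suc ⌊log₂ n ⌋
n<2^[1+⌊log₂n⌋] n = ≰⇒> λ 2^[1+⌊log₂n⌋]≤n → n≮n ⌊log₂ n ⌋ (begin-strict
    ⌊log₂ n ⌋                    <⟨ n<1+n ⌊log₂ n ⌋ ⟩
    suc ⌊log₂ n ⌋                ≡⟨ sym (⌊log₂[2^n]⌋≡n (suc ⌊log₂ n ⌋)) ⟩
    ⌊log₂ 2 ^ suc ⌊log₂ n ⌋ ⌋    ≤⟨ ⌊log₂⌋-mono-≤ 2^[1+⌊log₂n⌋]≤n ⟩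
    ⌊log₂ n ⌋                    ∎)
  where open ≤-Reasoning

⌊log₂n⌋≤n : ∀ n → ⌊log₂ n ⌋ ≤ n
⌊log₂n⌋≤n n = ≤-trans (⌊log₂⌋-mono-≤ (<⇒≤ (n<2^n n))) (≤-reflexive (⌊log₂[2^n]⌋≡n n))

ilog≤ : ∀ m x → ilog m x ≤ x
ilog≤ zero    x = ≤-refl
ilog≤ (suc m) x = ≤-trans (⌊log₂n⌋≤n (ilog m x)) (ilog≤ m x)

ilog-mono-≤ : ∀ m {x y} → x ≤ y → ilog m x ≤ ilog m y
ilog-mono-≤ zero    x≤y = x≤y
ilog-mono-≤ (suc m) x≤y = ⌊log₂⌋-mono-≤ (ilog-mono-≤ m x≤y)

tower : ℕ → ℕ → ℕ
tower zero    a = a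
tower (suc m) a = tower m (2 ^ a)

ilog-tower : ∀ m a → ilog m (tower m a) ≡ a
ilog-tower zero    a = refl
ilog-tower (suc m) a = trans (cong ⌊log₂_⌋ (ilog-tower m (2 ^ a))) (⌊log₂[2^n]⌋≡n a)

n≤tower : ∀ m a → a ≤ tower m a
n≤tower zero    a = ≤-refl
n≤tower (suc m) a = ≤-trans (<⇒≤ (n<2^n a)) (n≤tower m (2 ^ a))

m<m/n*n+n : ∀ m n .{{_ : NonZero n}} → m < m / n * n + n
m<m/n*n+n m n = begin-strict
    m                      ≡⟨ m≡m%n+[m/n]*n m n ⟩
    m % n + m / n * n      <⟨ +-monoˡ-< (m / n * n) (m%n<n m n) ⟩
    n + m / n * n          ≡⟨ +-comm n (m / n * n) ⟩
    m / n * n + n          ∎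
  where open ≤-Reasoning

∈-applyUpTo-interval : ∀ {a L r} → a ≤ r → r < a + L → r ∈ applyUpTo (a +_) L
∈-applyUpTo-interval {a} {L} {r} a≤r r<a+L = subst (_∈ applyUpTo (a +_) L) (m+[n∸m]≡n a≤r)
  (∈-applyUpTo⁺ (a +_) (subst (r ∸ a <_) (m+n∸m≡n a L) (∸-monoˡ-< r<a+L a≤r)))

-- One round

module Round {n : ℕ} (b : ℕ) (S : Fin n → Bool) (g : Fin n → Fin n) where

  private instance
    2^b≢0 : NonZero (2 ^ b)
    2^b≢0 = m^n≢0 2 b

  R : Fin n → Bool
  R = S ∘ g

  W : ℕ
  W = ∣ R ∣

  T : ℕ
  T = suc (W / 2 ^ b)

  weight : Fin n → ℕ
  weight v = ∣ (λ y → does (g y ≟ v)) ∣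

  -- Listing R by image, the preimages of v occupy the positions below v, …, below v + weight v − 1.
  below : Fin n → ℕ
  below v = ∣ (λ y → R y ∧ does (toℕ (g y) <? toℕ v)) ∣

  classify : ℕ → ℕ → Code
  classify zero    c = absent
  classify (suc w) c with T ≤? suc w
  ... | yes _ = heavy c
  ... | no  _ = light c

  code : Fin n → Code
  code v = classify (weight v) (below v / T)

  T≤1+n/2^b : T ≤ suc (n / 2 ^ b)
  T≤1+n/2^b = s≤s (/-monoˡ-≤ (2 ^ b) (∣p∣≤n R))

  code-fits : ∀ v → FitsIn b (code v)
  code-fits v = fits (weight v)
    where
      W<2^b*T : W < 2 ^ b * T
      W<2^b*T = begin-strict
        W                        <⟨ m<m/n*n+n W (2 ^ b) ⟩
        W / 2 ^ b * 2 ^ b + 2 ^ b ≡⟨ +-comm (W / 2 ^ b * 2 ^ b) (2 ^ b) ⟩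
        T * 2 ^ b                ≡⟨ *-comm T (2 ^ b) ⟩
        2 ^ b * T                ∎
        where open ≤-Reasoning
      index< : below v / T < 2 ^ b
      index< = m<n*o⇒m/o<n (≤-<-trans (∣∣-mono _ R (λ y → ∧-trueˡ (R y))) W<2^b*T)
      fits : ∀ w → FitsIn b (classify w (below v / T))
      fits zero = _
      fits (suc w) with T ≤? suc w
      ... | yes _ = index<
      ... | no  _ = index<

  classify-heavy : ∀ {w c c′} → classify w c ≡ heavy c′ → T ≤ w × c ≡ c′
  classify-heavy {suc w} eq with T ≤? suc w
  classify-heavy {suc w} refl | yes T≤w = T≤w , refl

  classify-light : ∀ {w c c′} → classify w c ≡ light c′ → w < T × c ≡ c′
  classify-light {suc w} eq with T ≤? suc w
  classify-light {suc w} refl | no T≰w = ≰⇒> T≰w , refl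

  below+weight≤below : ∀ {u v} → S u ≡ true → toℕ u < toℕ v → below u + weight u ≤ below v
  below+weight≤below {u} {v} Su u<v = begin
      below u + weight u
        ≤⟨ +-mono-≤ (∣∣-mono _ _ below-u) (∣∣-mono _ _ at-u) ⟩
      ∣ (λ y → below-v y ∧ lt-u y) ∣ + ∣ (λ y → below-v y ∧ not (lt-u y)) ∣
        ≡⟨ sym (count-split below-v lt-u (allFin n)) ⟩
      below v ∎
    where
      open ≤-Reasoning
      lt-u below-v : Fin n → Bool
      lt-u y = does (toℕ (g y) <? toℕ u)
      below-v y = R y ∧ does (toℕ (g y) <? toℕ v)
      below-u : ∀ y → R y ∧ lt-u y ≡ true → below-v y ∧ lt-u y ≡ true
      below-u y eq = ∧-true (∧-true (∧-trueˡ (R y) eq)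
        (dec-true (_ <? _) (<-trans (does⇒ (_ <? _) (∧-trueʳ (R y) eq)) u<v))) (∧-trueʳ (R y) eq)
      at-u : ∀ y → does (g y ≟ u) ≡ true → below-v y ∧ not (lt-u y) ≡ true
      at-u y eq with does⇒ (g y ≟ u) eq
      ... | refl = ∧-true (∧-true Su (dec-true (_ <? _) u<v))
                          (cong not (dec-false (_ <? _) (n≮n (toℕ u))))

  siblingsBefore : Fin n → ℕ
  siblingsBefore y = ∣ (λ y′ → does (g y′ ≟ g y) ∧ does (toℕ y′ <? toℕ y)) ∣

  -- The position of y when R is listed by image, ties broken by index.
  rank : Fin n → ℕ
  rank y = below (g y) + siblingsBefore y

  siblingsBefore<weight : ∀ y → siblingsBefore y < weight (g y)
  siblingsBefore<weight y = count-mono-< _ _ (allFin n)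
    (λ y′ _ eq → ∧-trueˡ (does (g y′ ≟ g y)) eq) (∈-allFin y) (dec-true (g y ≟ g y) refl)
    (trans (cong (does (g y ≟ g y) ∧_) (dec-false (toℕ y <? toℕ y) (n≮n (toℕ y)))) (∧-zeroʳ _))

  rank<-image : ∀ {y y′} → R y ≡ true → toℕ (g y) < toℕ (g y′) → rank y < rank y′
  rank<-image {y} {y′} Ry gy<gy′ = begin-strict
    below (g y) + siblingsBefore y  <⟨ +-monoʳ-< (below (g y)) (siblingsBefore<weight y) ⟩
    below (g y) + weight (g y)      ≤⟨ below+weight≤below Ry gy<gy′ ⟩
    below (g y′)                    ≤⟨ m≤m+n (below (g y′)) (siblingsBefore y′) ⟩
    rank y′                         ∎
    where open ≤-Reasoning

  rank<-sibling : ∀ {y y′} → g y ≡ g y′ → toℕ y < toℕ y′ → rank y < rank y′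
  rank<-sibling {y} {y′} gy≡gy′ y<y′ rewrite gy≡gy′ = +-monoʳ-< (below (g y′))
    (count-mono-< _ _ (allFin n) earlier (∈-allFin y)
      (∧-true (dec-true (g y ≟ g y′) gy≡gy′) (dec-true (toℕ y <? toℕ y′) y<y′))
      (trans (cong (does (g y ≟ g y′) ∧_) (dec-false (toℕ y <? toℕ y) (n≮n (toℕ y)))) (∧-zeroʳ _)))
    where
      earlier : ∀ a → a ∈ allFin n → does (g a ≟ g y′) ∧ does (toℕ a <? toℕ y) ≡ true →
                does (g a ≟ g y′) ∧ does (toℕ a <? toℕ y′) ≡ true
      earlier a _ eq = ∧-true (∧-trueˡ (does (g a ≟ g y′)) eq)
        (dec-true (_ <? _) (<-trans (does⇒ (_ <? _) (∧-trueʳ (does (g a ≟ g y′)) eq)) y<y′))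

  rank-injective : ∀ {y y′} → R y ≡ true → R y′ ≡ true → rank y ≡ rank y′ → y ≡ y′
  rank-injective {y} {y′} Ry Ry′ eq with <-cmp (toℕ (g y)) (toℕ (g y′))
  ... | tri< gy<gy′ _ _ = contradiction eq (<⇒≢ (rank<-image Ry gy<gy′))
  ... | tri> _ _ gy>gy′ = contradiction eq (≢-sym (<⇒≢ (rank<-image Ry′ gy>gy′)))
  ... | tri≈ _ gy≡gy′ _ with <-cmp (toℕ y) (toℕ y′)
  ...   | tri< y<y′ _ _ = contradiction eq (<⇒≢ (rank<-sibling (toℕ-injective gy≡gy′) y<y′))
  ...   | tri≈ _ y≡y′ _ = toℕ-injective y≡y′
  ...   | tri> _ _ y>y′ = contradiction eq
          (≢-sym (<⇒≢ (rank<-sibling (sym (toℕ-injective gy≡gy′)) y>y′)))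

  heavy-< : ∀ {u v} → S u ≡ true → T ≤ weight u → toℕ u < toℕ v → below u / T < below v / T
  heavy-< {u} {v} Su T≤wu u<v = begin-strict
      below u / T                    <⟨ n<1+n (below u / T) ⟩
      suc (below u / T)              ≡⟨ sym (m*n/n≡m (suc (below u / T)) T) ⟩
      suc (below u / T) * T / T      ≤⟨ /-monoˡ-≤ T next-block≤ ⟩
      below v / T                    ∎
    where
      open ≤-Reasoning
      next-block≤ : suc (below u / T) * T ≤ below v
      next-block≤ = begin
        T + below u / T * T     ≤⟨ +-mono-≤ T≤wu (m/n*n≤m (below u) T) ⟩
        weight u + below u      ≡⟨ +-comm (weight u) (below u) ⟩
        below u + weight u      ≤⟨ below+weight≤below Su u<v ⟩
        below v                 ∎

  heavy-injective : ∀ {u v} → S u ≡ true → S v ≡ true → T ≤ weight u → T ≤ weight v →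
    below u / T ≡ below v / T → u ≡ v
  heavy-injective {u} {v} Su Sv T≤wu T≤wv eq with <-cmp (toℕ u) (toℕ v)
  ... | tri< u<v _ _ = contradiction eq (<⇒≢ (heavy-< Su T≤wu u<v))
  ... | tri≈ _ u≡v _ = toℕ-injective u≡v
  ... | tri> _ _ u>v = contradiction eq (≢-sym (<⇒≢ (heavy-< Sv T≤wv u>v)))

  light-class-bound : (Q : Fin n → Bool) (c : ℕ) →
    (∀ y → Q y ≡ true → R y ≡ true × code (g y) ≡ light c) → ∣ Q ∣ ≤ 2 * T
  light-class-bound Q c inClass = subst (∣ Q ∣ ≤_) (length-applyUpTo (c * T +_) (2 * T))
    (count-injection Q (applyUpTo (c * T +_) (2 * T)) rank (Unique.allFin⁺ n)
      (λ y _ Qy → ∈-applyUpTo-interval (rank-lower y Qy) (rank-upper y Qy))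
      (λ _ _ Qa Qb → rank-injective (proj₁ (inClass _ Qa)) (proj₁ (inClass _ Qb))))
    where
      open ≤-Reasoning
      rank-lower : ∀ y → Q y ≡ true → c * T ≤ rank y
      rank-lower y Qy with classify-light {weight (g y)} {below (g y) / T} (proj₂ (inClass y Qy))
      ... | _ , refl = begin
        below (g y) / T * T   ≤⟨ m/n*n≤m (below (g y)) T ⟩
        below (g y)           ≤⟨ m≤m+n (below (g y)) (siblingsBefore y) ⟩
        rank y                ∎
      rank-upper : ∀ y → Q y ≡ true → rank y < c * T + 2 * T
      rank-upper y Qy with classify-light {weight (g y)} {below (g y) / T} (proj₂ (inClass y Qy))
      ... | w<T , refl = begin-strict
        below (g y) + siblingsBefore y  <⟨ +-mono-<-≤ (m<m/n*n+n (below (g y)) T)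
                                             (≤-trans (<⇒≤ (siblingsBefore<weight y)) (<⇒≤ w<T)) ⟩
        (c * T + T) + T                 ≡⟨ +-assoc (c * T) T T ⟩
        c * T + (T + T)                 ≡⟨ cong (λ t → c * T + (T + t)) (sym (+-identityʳ T)) ⟩
        c * T + 2 * T                   ∎

  classify≢absent⇒1≤w : ∀ w {c} → classify w c ≢ absent → 1 ≤ w
  classify≢absent⇒1≤w zero    absent≢absent = contradiction refl absent≢absent
  classify≢absent⇒1≤w (suc w) _             = s≤s z≤n

  1≤w⇒classify≢absent : ∀ {w c} → 1 ≤ w → classify w c ≢ absent
  1≤w⇒classify≢absent {suc w} _ with T ≤? suc w
  ... | yes _ = λ ()
  ... | no  _ = λ ()

  refine : Fin n → Fin n → Bool
  refine x v = S v ∧ does (encode b (code v) ≟ᴮ encode b (code (g x)))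

  module _ {x : Fin n} (Rx : R x ≡ true) where

    refine-answer : refine x (g x) ≡ true
    refine-answer = ∧-true Rx (dec-true (encode b (code (g x)) ≟ᴮ encode b (code (g x))) refl)

    refine⊆S : ∀ {v} → refine x v ≡ true → S v ≡ true
    refine⊆S {v} = ∧-trueˡ (S v)

    refine-code : ∀ {v} → refine x v ≡ true → code v ≡ code (g x)
    refine-code {v} eq =
      encode-injective b (code-fits v) (code-fits (g x)) (does⇒ (_ ≟ᴮ _) (∧-trueʳ (S v) eq))

    weight≥1 : 1 ≤ weight (g x)
    weight≥1 = count-pos _ (allFin n) (∈-allFin x) (dec-true (g x ≟ g x) refl)

    answer-present : code (g x) ≢ absent
    answer-present = 1≤w⇒classify≢absent weight≥1

    refine⊆image : refine x ⊆-image g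
    refine⊆image v eq =
      let y , _ , gy≟v = count-witness _ (allFin n)
            (classify≢absent⇒1≤w (weight v) (λ absent → answer-present (trans (sym (refine-code eq)) absent)))
      in y , does⇒ (g y ≟ v) gy≟v

    refine-heavy : ∀ {c} → code (g x) ≡ heavy c → ∣ refine x ∣ ≤ 1
    refine-heavy {c} heavy-c = ∣∣≤1 (refine x) λ {u} {v} ru rv →
      let T≤wu , iu = classify-heavy {weight u} {below u / T} (trans (refine-code ru) heavy-c)
          T≤wv , iv = classify-heavy {weight v} {below v / T} (trans (refine-code rv) heavy-c)
      in heavy-injective (refine⊆S ru) (refine⊆S rv) T≤wu T≤wv (trans iu (sym iv))

    refine-Narrowed : Narrowed (refine x) g (2 * suc (n / 2 ^ b))
    refine-Narrowed = by-answer-code (code (g x)) refl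
      where
        by-answer-code : ∀ c → code (g x) ≡ c → Narrowed (refine x) g (2 * suc (n / 2 ^ b))
        by-answer-code absent    eq = contradiction eq answer-present
        by-answer-code (heavy c) eq = inj₁ (refine-heavy eq)
        by-answer-code (light c) eq = inj₂ (refine⊆image , ≤-trans
          (light-class-bound (refine x ∘ g) c (λ y ry → refine⊆S ry , trans (refine-code ry) eq))
          (*-monoʳ-≤ 2 T≤1+n/2^b))

    refine-final : W < 2 ^ b → ∣ refine x ∣ ≤ 1
    refine-final W<2^b = by-answer-code (code (g x)) refl
      where
        by-answer-code : ∀ c → code (g x) ≡ c → ∣ refine x ∣ ≤ 1
        by-answer-code absent    eq = contradiction eq answer-present
        by-answer-code (heavy c) eq = refine-heavy eq
        by-answer-code (light c) eq = contradiction (cong suc (m<n⇒m/n≡0 W<2^b))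
          (>⇒≢ (≤-trans (s≤s weight≥1) (proj₁ (classify-light {weight (g x)} {below (g x) / T} eq))))

-- Messages

module _ {n : ℕ} (b : ℕ) where

  write : (Fin n → Bool) → (Fin n → Fin n) → Bits
  write S g = if does (∣ S ∣ ≤? 1) then [] else body
    where
      open Round b S g
      body : Bits
      body = tabulate R ++ concatMap (encode b ∘ code) (filterᵇ S (allFin n))
                         ++ concatMap (encode b ∘ code ∘ g) (filterᵇ R (allFin n))

  codeBlock : (Fin n → Bool) → Bits → Fin n → Bits
  codeBlock S m = blockAt (2 + b) (filterᵇ S (allFin n)) (drop n m)

  answerBlock : (Fin n → Bool) → Bits → Fin n → Bits
  answerBlock S m = blockAt (2 + b) (filterᵇ (bitAt m) (allFin n)) (drop (∣ S ∣ * (2 + b)) (drop n m))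

  -- The reader does not know g: it recovers R from the first n bits and, knowing x ∈ R, finds the
  -- code of g x among the codes written for R.
  read : (Fin n → Bool) → Bits → Fin n → Fin n → Bool
  read S m x = if does (∣ S ∣ ≤? 1) then S else λ v → S v ∧ does (codeBlock S m v ≟ᴮ answerBlock S m x)

  write-small : ∀ {S} g → ∣ S ∣ ≤ 1 → write S g ≡ []
  write-small {S} g ∣S∣≤1 rewrite dec-true (∣ S ∣ ≤? 1) ∣S∣≤1 = refl

  read-small : ∀ {S} m x → ∣ S ∣ ≤ 1 → read S m x ≡ S
  read-small {S} m x ∣S∣≤1 rewrite dec-true (∣ S ∣ ≤? 1) ∣S∣≤1 = refl

  read-large : ∀ {S} m x v → 1 < ∣ S ∣ → read S m x v ≡ S v ∧ does (codeBlock S m v ≟ᴮ answerBlock S m x)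
  read-large {S} m x v ∣S∣≥2 rewrite dec-false (∣ S ∣ ≤? 1) (<⇒≱ ∣S∣≥2) = refl

  module _ {S : Fin n → Bool} {g : Fin n → Fin n} (∣S∣≥2 : 1 < ∣ S ∣) where
    open Round b S g

    private
      Ss Rs : List (Fin n)
      Ss = filterᵇ S (allFin n)
      Rs = filterᵇ R (allFin n)
      length-code : ∀ v → length (encode b (code v)) ≡ 2 + b
      length-code v = length-encode b (code v)
      codesOfS codesOfR : Bits
      codesOfS = concatMap (encode b ∘ code) Ss
      codesOfR = concatMap (encode b ∘ code ∘ g) Rs

    write-large : write S g ≡ tabulate R ++ codesOfS ++ codesOfR
    write-large rewrite dec-false (∣ S ∣ ≤? 1) (<⇒≱ ∣S∣≥2) = refl

    drop-write : drop n (write S g) ≡ codesOfS ++ codesOfR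
    drop-write = trans (cong (drop n) write-large) (drop-tabulate-++ R (codesOfS ++ codesOfR))

    codeBlock-write : ∀ {v} → S v ≡ true → codeBlock S (write S g) v ≡ encode b (code v)
    codeBlock-write {v} Sv = begin
      blockAt (2 + b) Ss (drop n (write S g)) v  ≡⟨ cong (λ bs → blockAt (2 + b) Ss bs v) drop-write ⟩
      blockAt (2 + b) Ss (codesOfS ++ codesOfR) v
        ≡⟨ blockAt-concatMap (2 + b) (encode b ∘ code) length-code Ss codesOfR
             (∈-filterᵇ⁺ S (∈-allFin v) Sv) ⟩
      encode b (code v)                           ∎
      where open ≡-Reasoning

    answerBlock-write : ∀ {x} → R x ≡ true → answerBlock S (write S g) x ≡ encode b (code (g x))
    answerBlock-write {x} Rx = begin
      blockAt (2 + b) (filterᵇ (bitAt (write S g)) (allFin n)) (drop (∣ S ∣ * (2 + b)) (drop n (write S g))) x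
        ≡⟨ cong₂ (λ ks bs → blockAt (2 + b) ks bs x) received-R received-codes ⟩
      blockAt (2 + b) Rs (codesOfR ++ []) x
        ≡⟨ blockAt-concatMap (2 + b) (encode b ∘ code ∘ g) (length-code ∘ g) Rs []
             (∈-filterᵇ⁺ R (∈-allFin x) Rx) ⟩
      encode b (code (g x))  ∎
      where
        open ≡-Reasoning
        received-R : filterᵇ (bitAt (write S g)) (allFin n) ≡ Rs
        received-R = filterᵇ-cong _ R (allFin n) λ y _ →
          trans (cong (λ m → bitAt m y) write-large) (bitAt-tabulate-++ R (codesOfS ++ codesOfR) y)
        received-codes : drop (∣ S ∣ * (2 + b)) (drop n (write S g)) ≡ codesOfR ++ []
        received-codes = begin
          drop (∣ S ∣ * (2 + b)) (drop n (write S g))   ≡⟨ cong (drop (∣ S ∣ * (2 + b))) drop-write ⟩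
          drop (∣ S ∣ * (2 + b)) (codesOfS ++ codesOfR)
            ≡⟨ drop-concatMap (2 + b) (encode b ∘ code) length-code Ss codesOfR ⟩
          codesOfR                                      ≡⟨ sym (++-identityʳ codesOfR) ⟩
          codesOfR ++ []                                ∎

    read-write : ∀ {x} → R x ≡ true → ∀ v → read S (write S g) x v ≡ refine x v
    read-write {x} Rx v with S v in Sv | read-large (write S g) x v ∣S∣≥2
    ... | false | eq = eq
    ... | true  | eq = trans eq (cong₂ (λ c c′ → does (c ≟ᴮ c′)) (codeBlock-write Sv) (answerBlock-write Rx))

    length-write-large : length (write S g) ≡ n + (∣ S ∣ + ∣ R ∣) * (2 + b)
    length-write-large = begin
      length (write S g)                                    ≡⟨ cong length write-large ⟩
      length (tabulate R ++ codesOfS ++ codesOfR)           ≡⟨ length-++ (tabulate R) ⟩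
      length (tabulate R) + length (codesOfS ++ codesOfR)   ≡⟨ cong₂ _+_ (length-tabulate R) (length-++ codesOfS) ⟩
      n + (length codesOfS + length codesOfR)
        ≡⟨ cong (n +_) (cong₂ _+_ (length-concatMap (2 + b) _ length-code Ss)
                                  (length-concatMap (2 + b) _ (length-code ∘ g) Rs)) ⟩
      n + (∣ S ∣ * (2 + b) + ∣ R ∣ * (2 + b))
        ≡⟨ cong (n +_) (sym (*-distribʳ-+ (2 + b) ∣ S ∣ ∣ R ∣)) ⟩
      n + (∣ S ∣ + ∣ R ∣) * (2 + b)                         ∎
      where open ≡-Reasoning

  length-write : ∀ S g → length (write S g) ≤ n + (∣ S ∣ + ∣ S ∘ g ∣) * (2 + b)
  length-write S g with ∣ S ∣ ≤? 1
  ... | yes ∣S∣≤1 = ≤-trans (≤-reflexive (cong length (write-small g ∣S∣≤1))) z≤n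
  ... | no  ∣S∣≰1 = ≤-reflexive (length-write-large (≰⇒> ∣S∣≰1))

-- The protocol

first-message-bound : ∀ n L → 1 ≤ L → n + (n + n) * (2 + suc L) ≤ 29 * (n * L)
first-message-bound n L 1≤L = begin
    n + (n + n) * (2 + suc L)    ≡⟨ expand n L ⟩
    7 * (n * 1) + 2 * (n * L)    ≤⟨ +-monoˡ-≤ (2 * (n * L)) (*-monoʳ-≤ 7 (*-monoʳ-≤ n 1≤L)) ⟩
    7 * (n * L) + 2 * (n * L)    ≡⟨ sym (*-distribʳ-+ (n * L) 7 2) ⟩
    9 * (n * L)                  ≤⟨ *-monoˡ-≤ (n * L) (m≤m+n 9 20) ⟩
    29 * (n * L)                 ∎
  where
    open ≤-Reasoning
    expand : ∀ n L → n + (n + n) * (2 + suc L) ≡ 7 * (n * 1) + 2 * (n * L)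
    expand = solve-∀

later-message-bound : ∀ n X D .{{_ : NonZero D}} → X < D → X ≤ n → 1 ≤ n →
  n + (2 * suc (n / D) + 2 * suc (n / D)) * (2 + suc X) ≤ 29 * n
later-message-bound n X D X<D X≤n 1≤n = begin
    n + (2 * suc a + 2 * suc a) * (2 + suc X)  ≡⟨ expand n a X ⟩
    n + 4 * (a * (3 + X)) + 4 * X + 12 * 1     ≤⟨ +-mono-≤ (+-mono-≤ (+-monoʳ-≤ n (*-monoʳ-≤ 4 blocks≤3n))
                                                   (*-monoʳ-≤ 4 X≤n)) (*-monoʳ-≤ 12 1≤n) ⟩
    n + 4 * (3 * n) + 4 * n + 12 * n           ≡⟨ collect n ⟩
    29 * n                                     ∎
  where
    open ≤-Reasoning
    a = n / D
    expand : ∀ n a X → n + (2 * suc a + 2 * suc a) * (2 + suc X) ≡ n + 4 * (a * (3 + X)) + 4 * X + 12 * 1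
    expand = solve-∀
    collect : ∀ n → n + 4 * (3 * n) + 4 * n + 12 * n ≡ 29 * n
    collect = solve-∀
    blocks≤3n : a * (3 + X) ≤ 3 * n
    blocks≤3n = begin
      a * (3 + X)        ≤⟨ *-monoʳ-≤ a (+-monoʳ-≤ 3 (m≤n*m X 3)) ⟩
      a * (3 + 3 * X)    ≡⟨ cong (a *_) (sym (*-suc 3 X)) ⟩
      a * (3 * suc X)    ≡⟨ *-comm a (3 * suc X) ⟩
      3 * suc X * a      ≡⟨ *-assoc 3 (suc X) a ⟩
      3 * (suc X * a)    ≤⟨ *-monoʳ-≤ 3 (*-monoˡ-≤ a X<D) ⟩
      3 * (D * a)        ≡⟨ cong (3 *_) (*-comm D a) ⟩
      3 * (a * D)        ≤⟨ *-monoʳ-≤ 3 (m/n*n≤m n D) ⟩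
      3 * n              ∎

module _ {n : ℕ} where

  comp-++ : (fs gs : List (Fun n)) (x : Fin n) → comp (fs ++ gs) x ≡ comp gs (comp fs x)
  comp-++ []       gs x = refl
  comp-++ (f ∷ fs) gs x = comp-++ fs gs (f x)

  comp-drop-take : ∀ s (fs : List (Fun n)) (x : Fin n) → comp (drop s fs) (comp (take s fs) x) ≡ comp fs x
  comp-drop-take s fs x =
    trans (sym (comp-++ (take s fs) (drop s fs) x)) (cong (λ hs → comp hs x) (take++drop≡id s fs))

  comp-drop-lookup : ∀ {l} (fs : Vec (Fun n) l) (t : Fin l) (x : Fin n) →
    comp (drop (toℕ t) (toList fs)) x ≡ comp (drop (suc (toℕ t)) (toList fs)) (lookup fs t x)
  comp-drop-lookup (f ∷ fs) zero    x = refl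
  comp-drop-lookup (f ∷ fs) (suc t) x = comp-drop-lookup fs t x

  comp-drop-injective : ∀ {l} (fs : Vec (Fun n) l) s →
    (∀ t → s ≤ toℕ t → Injective _≡_ _≡_ (lookup fs t)) → Injective _≡_ _≡_ (comp (drop s (toList fs)))
  comp-drop-injective []       zero    _   eq = eq
  comp-drop-injective []       (suc s) _   eq = eq
  comp-drop-injective (f ∷ fs) zero    inj eq =
    inj zero z≤n (comp-drop-injective fs zero (λ t _ → inj (suc t) z≤n) eq)
  comp-drop-injective (f ∷ fs) (suc s) inj eq =
    comp-drop-injective fs s (λ t s≤t → inj (suc t) (s≤s s≤t)) eq

sum-map-≤ : {A : Set} (f : A → ℕ) {B : ℕ} (xs : List A) → All.All (λ a → f a ≤ B) xs →
  sum (map f xs) ≤ length xs * B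
sum-map-≤ f []       All.[]              = z≤n
sum-map-≤ f (x ∷ xs) (fx≤B All.∷ rest) = +-mono-≤ fx≤B (sum-map-≤ f xs rest)

module _ {k n : ℕ} (P : CollapsingProtocol k n) (i : Fin n) (fs : Vec (Fun n) (k ∸ 1)) where

  length-transcript : ∀ q → length (transcript P i fs q) ≡ suc q
  length-transcript zero    = refl
  length-transcript (suc q) =
    trans (length-++ (transcript P i fs q)) (trans (cong (_+ 1) (length-transcript q)) (+-comm (suc q) 1))

-- k = 2 + m players and n = suc n′ points; decoding needs a default point.
module Protocol (m n′ : ℕ) where

  n : ℕ
  n = suc n′

  -- Player s + 1 writes codes of width log^{(k−1−s)} n + 1.
  width : ℕ → ℕ
  width s = suc (ilog (suc m ∸ s) n)

  budget : ℕ
  budget = 29 * (n * ilog (suc m) n)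

  -- Capping makes the cost bound unconditional; under the permutation hypothesis nothing is cut.
  cap : Bits → Bits
  cap bs with length bs ≤? budget
  ... | yes _ = bs
  ... | no  _ = []

  everything : Fin n → Bool
  everything _ = true

  trajectory : Fin n → List (Fun n) → List (Fin n)
  trajectory x []       = x ∷ []
  trajectory x (f ∷ fs) = x ∷ trajectory (f x) fs

  replay : ℕ → (Fin n → Bool) → List (Fin n) → List Bits → Fin n → Bool
  replay s S (x ∷ xs) (bs ∷ bss) = replay (suc s) (read (width s) S bs x) xs bss
  replay s S _        _          = S

  candidates : Fin n → List (Fun n) → List Bits → Fin n → Bool
  candidates i pre msgs = replay 0 everything (trajectory i pre) msgs

  speak : ℕ → Fin n → List (Fun n) → Fun n → List Bits → Bits
  speak q i pre g msgs with q <? m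
  ... | yes _ = cap (write (width (suc q)) (candidates i pre msgs) g)
  ... | no  _ = tabulate (candidates i pre msgs)

  protocol : CollapsingProtocol (2 + m) n
  protocol = record
    { first  = λ g → cap (write (width 0) everything g)
    ; later  = speak
    ; decode = λ bs → search (bitAt bs) zero
    }

  length-cap : ∀ bs → length (cap bs) ≤ budget
  length-cap bs with length bs ≤? budget
  ... | yes fits = fits
  ... | no  _    = z≤n

  cap-fits : ∀ {bs} → length bs ≤ budget → cap bs ≡ bs
  cap-fits {bs} fits with length bs ≤? budget
  ... | yes _    = refl
  ... | no  ¬fits = contradiction fits ¬fits

  module _ (1≤L : 1 ≤ ilog (suc m) n) where

    n≤n*L : n ≤ n * ilog (suc m) n
    n≤n*L = m≤m*n n (ilog (suc m) n) {{>-nonZero 1≤L}}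

    n≤budget : n ≤ budget
    n≤budget = ≤-trans n≤n*L (m≤n*m (n * ilog (suc m) n) 29)

    length-speak : ∀ q i pre g msgs → length (speak q i pre g msgs) ≤ budget
    length-speak q i pre g msgs with q <? m
    ... | yes _ = length-cap (write (width (suc q)) (candidates i pre msgs) g)
    ... | no  _ = ≤-trans (≤-reflexive (length-tabulate (candidates i pre msgs))) n≤budget

    transcript-within-budget : ∀ i fs q → All.All (λ bs → length bs ≤ budget) (transcript protocol i fs q)
    transcript-within-budget i fs zero    = length-cap (write (width 0) everything (comp (toList fs))) All.∷ All.[]
    transcript-within-budget i fs (suc q) = All.++⁺ (transcript-within-budget i fs q)
      (length-speak q i (take q (toList fs)) (comp (drop (suc q) (toList fs))) (transcript protocol i fs q) All.∷ All.[])

    cost-bound : ∀ i fs → cost protocol i fs ≤ (29 * (2 + m)) * (n * ilog (suc m) n)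
    cost-bound i fs = begin
      sum (map length (msgs ++ last ∷ []))
        ≤⟨ sum-map-≤ length (msgs ++ last ∷ []) (All.++⁺ (transcript-within-budget i fs m)
             (length-speak m i (take m L) (comp (drop (suc m) L)) msgs All.∷ All.[])) ⟩
      length (msgs ++ last ∷ []) * budget
        ≡⟨ cong (_* budget) (trans (length-++ msgs) (cong (_+ 1) (length-transcript protocol i fs m))) ⟩
      (suc m + 1) * budget
        ≡⟨ regroup m (n * ilog (suc m) n) ⟩
      (29 * (2 + m)) * (n * ilog (suc m) n) ∎
      where
        open ≤-Reasoning
        L : List (Fun n)
        L = toList fs
        msgs : List Bits
        msgs = transcript protocol i fs m
        last : Bits
        last = lastMessage protocol i fs
        regroup : ∀ m X → (suc m + 1) * (29 * X) ≡ (29 * (2 + m)) * X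
        regroup = solve-∀

  speak-continues : ∀ {q i pre g msgs} → q < m →
    speak q i pre g msgs ≡ cap (write (width (suc q)) (candidates i pre msgs) g)
  speak-continues {q} q<m with q <? m
  ... | yes _   = refl
  ... | no  q≮m = contradiction q<m q≮m

  speak-ends : ∀ {i pre g msgs} → speak m i pre g msgs ≡ tabulate (candidates i pre msgs)
  speak-ends with m <? m
  ... | yes m<m = contradiction m<m (n≮n m)
  ... | no  _   = refl

  replay-snoc : ∀ s S xs msgs x bs → length xs ≡ length msgs →
    replay s S (xs ++ x ∷ []) (msgs ++ bs ∷ []) ≡ read (width (s + length xs)) (replay s S xs msgs) bs x
  replay-snoc s S []       []           x bs _  = cong (λ t → read (width t) S bs x) (sym (+-identityʳ s))
  replay-snoc s S (y ∷ ys) (cs ∷ msgs)  x bs eq =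
    trans (replay-snoc (suc s) (read (width s) S cs y) ys msgs x bs (suc-injective eq))
          (cong (λ t → read (width t) (replay (suc s) (read (width s) S cs y) ys msgs) bs x) (sym (+-suc s (length ys))))

  trajectory-snoc : ∀ x (fs : List (Fun n)) q → suc q ≤ length fs →
    trajectory x (take (suc q) fs) ≡ trajectory x (take q fs) ++ comp (take (suc q) fs) x ∷ []
  trajectory-snoc x (f ∷ fs) zero    _         = refl
  trajectory-snoc x (f ∷ fs) (suc q) (s≤s q<l) = cong (x ∷_) (trajectory-snoc (f x) fs q q<l)

  length-trajectory : ∀ x (fs : List (Fun n)) → length (trajectory x fs) ≡ suc (length fs)
  length-trajectory x []       = refl
  length-trajectory x (f ∷ fs) = cong suc (length-trajectory (f x) fs)

  module Run (i : Fin n) (fs : Vec (Fun n) (suc m)) where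

    L : List (Fun n)
    L = toList fs

    answer : Fin n
    answer = comp L i

    G : ℕ → Fun n
    G s = comp (drop s L)

    position : ℕ → Fin n
    position s = comp (take s L) i

    state : ℕ → Fin n → Bool
    message : ℕ → Bits
    state zero    = everything
    state (suc s) = read (width s) (state s) (message s) (position s)
    message s = cap (write (width s) (state s) (G s))

    length-take-L : ∀ {q} → q ≤ suc m → length (take q L) ≡ q
    length-take-L {q} q≤ = trans (length-take q L) (trans (cong (q ⊓_) (length-toList fs)) (m≤n⇒m⊓n≡m q≤))

    candidates-transcript : ∀ q → q ≤ m → candidates i (take q L) (transcript protocol i fs q) ≡ state (suc q)
    candidates-transcript zero    _   = refl
    candidates-transcript (suc q) q<m = begin
        replay 0 everything (trajectory i (take (suc q) L)) (msgs ++ spoken ∷ [])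
          ≡⟨ cong (λ xs → replay 0 everything xs (msgs ++ spoken ∷ []))
               (trajectory-snoc i L q (subst (suc q ≤_) (sym (length-toList fs)) (m≤n⇒m≤1+n q<m))) ⟩
        replay 0 everything (trajectory i (take q L) ++ position (suc q) ∷ []) (msgs ++ spoken ∷ [])
          ≡⟨ replay-snoc 0 everything (trajectory i (take q L)) msgs (position (suc q)) spoken
               (trans (length-trajectory i (take q L))
                 (trans (cong suc (length-take-L (<⇒≤ q<m′))) (sym (length-transcript protocol i fs q)))) ⟩
        read (width (length (trajectory i (take q L)))) (candidates i (take q L) msgs) spoken (position (suc q))
          ≡⟨ cong₂ (λ t S → read (width t) S spoken (position (suc q)))
               (trans (length-trajectory i (take q L)) (cong suc (length-take-L (<⇒≤ q<m′)))) ih ⟩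
        read (width (suc q)) (state (suc q)) spoken (position (suc q))
          ≡⟨ cong (λ bs → read (width (suc q)) (state (suc q)) bs (position (suc q))) spoken≡message ⟩
        state (suc (suc q)) ∎
      where
        open ≡-Reasoning
        q<m′ : q < suc m
        q<m′ = <-trans q<m (n<1+n m)
        msgs : List Bits
        msgs = transcript protocol i fs q
        spoken : Bits
        spoken = speak q i (take q L) (G (suc q)) msgs
        ih : candidates i (take q L) msgs ≡ state (suc q)
        ih = candidates-transcript q (<⇒≤ q<m)
        spoken≡message : spoken ≡ message (suc q)
        spoken≡message = trans (speak-continues q<m) (cong (λ S → cap (write (width (suc q)) S (G (suc q)))) ih)

    lastMessage-state : lastMessage protocol i fs ≡ tabulate (state (suc m))
    lastMessage-state = trans speak-ends (cong tabulate (candidates-transcript m ≤-refl))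

    G-answer : ∀ s → G s (position s) ≡ answer
    G-answer s = comp-drop-take s L i

    G-step : ∀ {s} (s<l : s < suc m) y → G s y ≡ G (suc s) (lookup fs (fromℕ< s<l) y)
    G-step {s} s<l y = subst (λ t → G t y ≡ G (suc t) (lookup fs (fromℕ< s<l) y)) (toℕ-fromℕ< s<l)
                             (comp-drop-lookup fs (fromℕ< s<l) y)

    Blocks : ℕ → ℕ
    Blocks s = 2 * suc (n / 2 ^ width s)
      where instance _ = m^n≢0 2 (width s)

    Progress : ℕ → Set
    Progress s = state (suc s) answer ≡ true × Narrowed (state (suc s)) (G s) (Blocks s)
                 × (n < 2 ^ width s → ∣ state (suc s) ∣ ≤ 1)

    round-progress : ∀ s → state s answer ≡ true → length (write (width s) (state s) (G s)) ≤ budget → Progress s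
    round-progress s answer∈ fits = by-size (∣ state s ∣ ≤? 1)
      where
        open Round (width s) (state s) (G s)
        R-position : R (position s) ≡ true
        R-position = subst (λ v → state s v ≡ true) (sym (G-answer s)) answer∈
        by-size : Dec (∣ state s ∣ ≤ 1) → Progress s
        by-size (yes small) =
          subst (λ S → S answer ≡ true × Narrowed S (G s) (Blocks s) × (n < 2 ^ width s → ∣ S ∣ ≤ 1))
            (sym (read-small (width s) {state s} (message s) (position s) small))
            (answer∈ , inj₁ small , λ _ → small)
        by-size (no large) =
            subst (_≡ true) (sym (refined answer))
              (subst (λ v → refine (position s) v ≡ true) (G-answer s) (refine-answer R-position))
          , Narrowed-cong (λ v → sym (refined v)) (refine-Narrowed R-position)
          , λ n<2^w → subst (_≤ 1) (∣∣-cong (refine (position s)) (state (suc s)) (λ v → sym (refined v)))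
                        (refine-final R-position (≤-<-trans (∣p∣≤n R) n<2^w))
          where
            refined : ∀ v → state (suc s) v ≡ refine (position s) v
            refined v = trans
              (cong (λ bs → read (width s) (state s) bs (position s) v) (cap-fits {write (width s) (state s) (G s)} fits))
              (read-write (width s) {state s} {G s} (≰⇒> large) R-position v)

    module _ (j₀ : ℕ)
             (bijective : (t : Fin (suc m)) → toℕ t + 2 ≢ j₀ → Bijective _≡_ _≡_ (lookup fs t)) where

      -- Either f_{s+2} is a bijection, or it is f_{j₀} and every later map is injective.
      preimage-shrinks : ∀ {s} (S : Fin n → Bool) → s < suc m → S ⊆-image G s →
        ∣ S ∘ G (suc s) ∣ ≤ ∣ S ∘ G s ∣
      preimage-shrinks {s} S s<l S⊆img with s + 2 ≟ℕ j₀
      ... | no s+2≢j₀ = begin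
          ∣ S ∘ G (suc s) ∣       ≤⟨ ∣∣-image (S ∘ G (suc s)) f (λ z _ → surjective z) ⟩
          ∣ S ∘ G (suc s) ∘ f ∣   ≡⟨ ∣∣-cong _ _ (λ y → cong S (sym (G-step s<l y))) ⟩
          ∣ S ∘ G s ∣             ∎
        where
          open ≤-Reasoning
          f : Fun n
          f = lookup fs (fromℕ< s<l)
          f-bijective : Bijective _≡_ _≡_ f
          f-bijective = bijective (fromℕ< s<l) (subst (λ t → t + 2 ≢ j₀) (sym (toℕ-fromℕ< s<l)) s+2≢j₀)
          surjective : ∀ z → ∃ λ y → f y ≡ z
          surjective z = proj₁ (proj₂ f-bijective z) , proj₂ (proj₂ f-bijective z) refl
      ... | yes refl = begin
          ∣ S ∘ G (suc s) ∣   ≤⟨ ∣∣-preimage-injective S (G (suc s)) later-injective ⟩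
          ∣ S ∣               ≤⟨ ∣∣-image S (G s) S⊆img ⟩
          ∣ S ∘ G s ∣         ∎
        where
          open ≤-Reasoning
          later-injective : Injective _≡_ _≡_ (G (suc s))
          later-injective = comp-drop-injective fs (suc s)
            (λ t s<t → proj₁ (bijective t (λ t+2≡s+2 → <⇒≢ (+-monoˡ-< 2 s<t) (sym t+2≡s+2))))

      module _ (1≤L : 1 ≤ ilog (suc m) n) where

        first-round-fits : length (write (width 0) everything (G 0)) ≤ budget
        first-round-fits = begin
          length (write (width 0) everything (G 0))
            ≤⟨ length-write (width 0) everything (G 0) ⟩
          n + (∣ everything ∣ + ∣ everything ∘ G 0 ∣) * (2 + width 0)
            ≤⟨ +-monoʳ-≤ n (*-monoˡ-≤ (2 + width 0)
                 (+-mono-≤ (∣p∣≤n everything) (∣p∣≤n (everything ∘ G 0)))) ⟩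
          n + (n + n) * (2 + width 0)
            ≤⟨ first-message-bound n (ilog (suc m) n) 1≤L ⟩
          budget ∎
          where open ≤-Reasoning

        later-round-fits : ∀ {s} → suc s ≤ m → Narrowed (state (suc s)) (G s) (Blocks s) →
          length (write (width (suc s)) (state (suc s)) (G (suc s))) ≤ budget
        later-round-fits {s} _ (inj₁ small) =
          ≤-trans (≤-reflexive (cong length (write-small (width (suc s)) {state (suc s)} (G (suc s)) small))) z≤n
        later-round-fits {s} s<m (inj₂ (S⊆img , ∣SG∣≤B)) = begin
          length (write (width (suc s)) S (G (suc s)))
            ≤⟨ length-write (width (suc s)) S (G (suc s)) ⟩
          n + (∣ S ∣ + ∣ S ∘ G (suc s) ∣) * (2 + width (suc s))
            ≤⟨ +-monoʳ-≤ n (*-monoˡ-≤ (2 + width (suc s)) (+-mono-≤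
                 (≤-trans (∣∣-image S (G s) S⊆img) ∣SG∣≤B)
                 (≤-trans (preimage-shrinks S (<-trans s<m (n<1+n m)) S⊆img) ∣SG∣≤B))) ⟩
          n + (Blocks s + Blocks s) * (2 + suc X)
            ≤⟨ later-message-bound n X (2 ^ width s) X<2^w (ilog≤ (m ∸ s) n) (s≤s z≤n) ⟩
          29 * n
            ≤⟨ *-monoʳ-≤ 29 (n≤n*L 1≤L) ⟩
          budget ∎
          where
            open ≤-Reasoning
            instance _ = m^n≢0 2 (width s)
            S : Fin n → Bool
            S = state (suc s)
            X : ℕ
            X = ilog (m ∸ s) n
            X<2^w : X < 2 ^ width s
            X<2^w = subst (λ t → X < 2 ^ suc (ilog t n)) (sym (+-∸-assoc 1 (<⇒≤ s<m))) (n<2^[1+⌊log₂n⌋] X)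

        progress : ∀ s → s ≤ m → Progress s
        progress zero    _   = round-progress 0 refl first-round-fits
        progress (suc s) s<m = round-progress (suc s) (proj₁ previous)
                                 (later-round-fits s<m (proj₁ (proj₂ previous)))
          where previous = progress s (<⇒≤ s<m)

        final-singleton : ∣ state (suc m) ∣ ≤ 1
        final-singleton = proj₂ (proj₂ (progress m ≤-refl))
          (subst (λ t → n < 2 ^ suc (ilog t n)) (sym (m+n∸n≡m 1 m)) (n<2^[1+⌊log₂n⌋] n))

        correct : output protocol i fs ≡ mpj i fs
        correct = ∣∣≤1⇒unique final final-singleton found (proj₁ (progress m ≤-refl))
          where
            final : Fin n → Bool
            final = state (suc m)
            received : ∀ y → bitAt (lastMessage protocol i fs) y ≡ final y
            received y = begin
              bitAt (lastMessage protocol i fs) y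
                ≡⟨ cong (λ bs → bitAt bs y) (trans lastMessage-state (sym (++-identityʳ _))) ⟩
              bitAt (tabulate final ++ []) y        ≡⟨ bitAt-tabulate-++ final [] y ⟩
              final y                               ∎
              where open ≡-Reasoning
            found : final (output protocol i fs) ≡ true
            found = trans (sym (received _))
              (search-correct (bitAt (lastMessage protocol i fs)) zero
                (trans (received answer) (proj₁ (progress m ≤-refl))))

theorem4p2 : (k j₀ : ℕ) → 2 ≤ k → 2 ≤ j₀ → j₀ ≤ k →
  ∃[ C ] ∃[ N ] ((n : ℕ) → N ≤ n →
    Σ (CollapsingProtocol k n) (λ P →
      ((i : Fin n) → (fs : Vec (Fun n) (k ∸ 1)) →
        cost P i fs ≤ C * (n * ilog (k ∸ 1) n))
      × ((i : Fin n) → (fs : Vec (Fun n) (k ∸ 1)) →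
        ((t : Fin (k ∸ 1)) → toℕ t + 2 ≢ j₀ → Bijective _≡_ _≡_ (lookup fs t)) →
        output P i fs ≡ mpj i fs)))
-- The range of j₀ is irrelevant: only the bijectivity of the f_j with j ≠ j₀ is used.
theorem4p2 (suc (suc m)) j₀ (s≤s (s≤s z≤n)) _ _ = 29 * (2 + m) , tower (suc m) 1 , λ where
  zero     N≤0 → contradiction (≤-trans (n≤tower (suc m) 1) N≤0) λ ()
  (suc n′) N≤n →
    let open Protocol m n′
        1≤L : 1 ≤ ilog (suc m) (suc n′)
        1≤L = subst (_≤ ilog (suc m) (suc n′)) (ilog-tower (suc m) 1) (ilog-mono-≤ (suc m) N≤n)
    in protocol , (λ i fs → cost-bound 1≤L i fs) , (λ i fs bijective → Run.correct i fs j₀ bijective 1≤L)
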